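{- Let $H$ be a graph and let $G=\mathsf{TS}_{\alpha(H)}(H)$. Then for every integer $k\geq \alpha(H)$, $G$ is a $\mathsf{TS}_k$-reconfiguration graph. More precisely, for every such $k$ there exists a graph $H'$ with $|V(H)|+k-\alpha(H)$ vertices and $|E(H)|$ edges such that $G\simeq \mathsf{TS}_k(H')$.
   Context: All graphs are finite, simple and undirected. An independent set of a graph is a set of pairwise non-adjacent vertices; $\alpha(H)$ is the maximum size of an independent set of $H$. For a positive integer $k$, $\mathsf{TS}_k(G)$ is the graph whose vertices are the independent sets of $G$ of size exactly $k$, where two such sets $I,J$ are adjacent iff there exist $u,v\in V(G)$ with $I\setminus J=\{u\}$, $J\setminus I=\{v\}$ and $uv\in E(G)$. A graph $F$ is a $\mathsf{TS}_k$-reconfiguration graph if there exists a graph $G$ with $F\simeq \mathsf{TS}_k(G)$. -}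

module Defs where

open import Data.Nat using (ℕ; _<?_)
open import Data.Bool using (Bool; true; false; T; not; _∧_)
open import Data.Fin using (Fin; toℕ)
open import Data.Fin.Subset using (Subset; _─_; ⁅_⁆; ∣_∣)
open import Data.Vec using (lookup)
open import Data.List using (List; foldr; allFin; length; filter; cartesianProduct)
open import Data.Product using (Σ; Σ-syntax; _×_; proj₁; proj₂)
open import Relation.Binary.PropositionalEquality using (_≡_)
open import Relation.Nullary.Decidable using (⌊_⌋; _×-dec_)
open import Data.Bool.Properties using (_≟_)
open import Function.Bundles using (_↔_; Inverse; _⇔_)

record SimpleGraph (n : ℕ) : Set where
  field
    adj   : Fin n → Fin n → Bool
    sym   : ∀ i j → adj i j ≡ adj j i
    irrfl : ∀ i → adj i i ≡ false
open SimpleGraph public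

pairs : (n : ℕ) → List (Fin n × Fin n)
pairs n = cartesianProduct (allFin n) (allFin n)

edgeCount : ∀ {n} → SimpleGraph n → ℕ
edgeCount {n} H =
  length (filter (λ p → (toℕ (proj₁ p) <? toℕ (proj₂ p)) ×-dec (adj H (proj₁ p) (proj₂ p) ≟ true)) (pairs n))

isIndependent : ∀ {n} → SimpleGraph n → Subset n → Bool
isIndependent {n} H S =
  foldr (λ p b → b ∧ (λ p → not (lookup S (proj₁ p) ∧ lookup S (proj₂ p) ∧ adj H (proj₁ p) (proj₂ p))) p) true (pairs n)

Independent : ∀ {n} → SimpleGraph n → Subset n → Set
Independent H S = T (isIndependent H S)

IsIndependenceNumber : ∀ {n} → SimpleGraph n → ℕ → Set
IsIndependenceNumber {n} H a =
  (Σ[ S ∈ Subset n ] (Independent H S × ∣ S ∣ ≡ a)) ×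
  (∀ (S : Subset n) → Independent H S → ∣ S ∣ Data.Nat.≤ a)

record Graph : Set₁ where
  field
    V   : Set
    Adj : V → V → Set
open Graph public

TS : ∀ {n} → ℕ → SimpleGraph n → Graph
TS {n} k H = record
  { V   = Σ[ S ∈ Subset n ] (Independent H S × ∣ S ∣ ≡ k)
  ; Adj = λ I J → Σ[ u ∈ Fin n ] Σ[ v ∈ Fin n ]
            ((proj₁ I ─ proj₁ J ≡ ⁅ u ⁆) × (proj₁ J ─ proj₁ I ≡ ⁅ v ⁆) × adj H u v ≡ true)
  }

_≃G_ : Graph → Graph → Set
G₁ ≃G G₂ = Σ[ f ∈ (V G₁ ↔ V G₂) ]
  (∀ x y → Adj G₁ x y ⇔ Adj G₂ (Inverse.to f x) (Inverse.to f y))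

-- Add k − α(H) isolated vertices to H.  Every independent set of size k in the
-- enlarged graph meets the old vertices in an independent set of H, hence in at
-- most α(H) vertices, so it must contain all the new vertices and meet H in a
-- maximum independent set.  Thus I ↦ I ∪ {new vertices} is a bijection, and
-- since the new vertices have no edges, token sliding moves correspond exactly.
module Submission where

open import Data.Bool using (Bool; true; false; T; not; _∧_)
open import Data.Bool.Properties using (_≟_; T-∧; T-not-≡; T-irrelevant)
open import Data.Empty using (⊥-elim)
import Data.Fin as Fin
open import Data.Fin using (Fin; toℕ; _↑ˡ_; _↑ʳ_; splitAt)
open import Data.Fin.Properties using (toℕ-↑ˡ; splitAt-↑ˡ; splitAt-↑ʳ; splitAt⁻¹-↑ˡ)
open import Data.Fin.Subset using (Subset; _─_; ⁅_⁆; ∣_∣; ⊤; ⊥; inside; outside)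
open import Data.Fin.Subset.Properties using (∣p∣≤n; ∣⊤∣≡n; ∣p∣≡n⇒p≡⊤; p─⊤≡⊥)
open import Data.List using (List; []; _∷_; _++_; map; length; filter; foldr; tabulate; allFin; cartesianProduct)
open import Data.List.Properties using (filter-++; filter-none; filter-≐; length-++; map-tabulate)
open import Data.List.Membership.Propositional.Properties using (∈-allFin; ∈-cartesianProduct⁺)
open import Data.List.Relation.Unary.All as All using (All)
open import Data.Nat using (ℕ; zero; suc; _+_; _∸_; _≤_; _<_; _<?_)
open import Data.Nat.Properties using (m≤n⇒m<n∨m≡n; <-irrefl; +-mono-<-≤; +-cancelˡ-≡; +-identityʳ; m+[n∸m]≡n; ≡-irrelevant)
open import Data.Product as Product using (Σ-syntax; _×_; _,_; proj₁; proj₂)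
open import Data.Sum using (_⊎_; inj₁; inj₂)
open import Data.Vec using (lookup; take; drop)
import Data.Vec as Vec
open import Data.Vec.Properties using (lookup-++ˡ; lookup-splitAt; take++drop≡id; ++-injectiveˡ)
open import Function using (_∘_; id)
open import Function.Bundles using (_⇔_; Equivalence; mk↔ₛ′; mk⇔)
open import Level using (Level)
open import Relation.Binary.PropositionalEquality using (_≡_; refl; sym; trans; cong; cong₂; subst; module ≡-Reasoning)
open import Relation.Nullary using (¬_; does)
open import Relation.Nullary.Decidable using (_×-dec_)
open import Relation.Unary using (Pred; Decidable; _≐_)

open import Defs hiding (sym)

private
  variable
    ℓa ℓp ℓq : Level
    A B C : Set ℓa
    n m : ℕ

count : {P : Pred A ℓp} → Decidable P → List A → ℕ
count P? xs = length (filter P? xs)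

module _ {P : Pred A ℓp} (P? : Decidable P) where

  count-++ : ∀ xs ys → count P? (xs ++ ys) ≡ count P? xs + count P? ys
  count-++ xs ys = trans (cong length (filter-++ P? xs ys)) (length-++ (filter P? xs))

  count-map : (f : B → A) → ∀ xs → count P? (map f xs) ≡ count (P? ∘ f) xs
  count-map f [] = refl
  count-map f (x ∷ xs) with does (P? (f x))
  ... | true  = cong suc (count-map f xs)
  ... | false = count-map f xs

  count-none : (∀ x → ¬ P x) → ∀ xs → count P? xs ≡ 0
  count-none ¬P xs = cong length (filter-none P? (All.universal ¬P xs))

  count-≐ : {Q : Pred A ℓq} (Q? : Decidable Q) → P ≐ Q → ∀ xs → count P? xs ≡ count Q? xs
  count-≐ Q? P≐Q xs = cong length (filter-≐ P? Q? P≐Q xs)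

module _ {P : Pred (A × A) ℓp} (P? : Decidable P) (f : B → A) (g : C → A)
         (¬P-g₁ : ∀ z y → ¬ P (g z , y)) (¬P-g₂ : ∀ x z → ¬ P (x , g z)) where

  private
    Q? : Decidable (P ∘ Product.map f f)
    Q? = P? ∘ Product.map f f

  count-cartesianProduct-nullˡ : ∀ zs ys → count P? (cartesianProduct (map g zs) ys) ≡ 0
  count-cartesianProduct-nullˡ []       ys = refl
  count-cartesianProduct-nullˡ (z ∷ zs) ys = begin
    count P? (map (g z ,_) ys ++ cartesianProduct (map g zs) ys)
      ≡⟨ count-++ P? (map (g z ,_) ys) _ ⟩
    count P? (map (g z ,_) ys) + count P? (cartesianProduct (map g zs) ys)
      ≡⟨ cong₂ _+_ (trans (count-map P? (g z ,_) ys) (count-none _ (¬P-g₁ z) ys))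
                   (count-cartesianProduct-nullˡ zs ys) ⟩
    0 ∎
    where open ≡-Reasoning

  count-cartesianProduct-++ : ∀ xs zs ys ws →
    count P? (cartesianProduct (map f xs ++ map g zs) (map f ys ++ map g ws))
      ≡ count Q? (cartesianProduct xs ys)
  count-cartesianProduct-++ []       zs ys ws = count-cartesianProduct-nullˡ zs _
  count-cartesianProduct-++ (x ∷ xs) zs ys ws = begin
    count P? (map (f x ,_) zs′ ++ cartesianProduct (map f xs ++ map g zs) zs′)
      ≡⟨ count-++ P? (map (f x ,_) zs′) _ ⟩
    count P? (map (f x ,_) zs′) + count P? (cartesianProduct (map f xs ++ map g zs) zs′)
      ≡⟨ cong₂ _+_ row (count-cartesianProduct-++ xs zs ys ws) ⟩
    count Q? (map (x ,_) ys) + count Q? (cartesianProduct xs ys)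
      ≡⟨ count-++ Q? (map (x ,_) ys) _ ⟨
    count Q? (cartesianProduct (x ∷ xs) ys) ∎
    where
    open ≡-Reasoning
    zs′ = map f ys ++ map g ws
    row : count P? (map (f x ,_) zs′) ≡ count Q? (map (x ,_) ys)
    row = begin
      count P? (map (f x ,_) zs′)
        ≡⟨ count-map P? (f x ,_) zs′ ⟩
      count (P? ∘ (f x ,_)) (map f ys ++ map g ws)
        ≡⟨ count-++ (P? ∘ (f x ,_)) (map f ys) (map g ws) ⟩
      count (P? ∘ (f x ,_)) (map f ys) + count (P? ∘ (f x ,_)) (map g ws)
        ≡⟨ cong₂ _+_ (count-map _ f ys)
                     (trans (count-map _ g ws) (count-none _ (¬P-g₂ (f x)) ws)) ⟩
      count (P? ∘ (f x ,_) ∘ f) ys + 0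
        ≡⟨ +-identityʳ _ ⟩
      count (P? ∘ (f x ,_) ∘ f) ys
        ≡⟨ count-map Q? (x ,_) ys ⟨
      count Q? (map (x ,_) ys) ∎

tabulate-+ : ∀ n m (f : Fin (n + m) → A) →
  tabulate f ≡ tabulate (f ∘ (_↑ˡ m)) ++ tabulate (f ∘ (n ↑ʳ_))
tabulate-+ zero    m f = refl
tabulate-+ (suc n) m f = cong (f Fin.zero ∷_) (tabulate-+ n m (f ∘ Fin.suc))

allFin-+ : ∀ n m → allFin (n + m) ≡ map (_↑ˡ m) (allFin n) ++ map (n ↑ʳ_) (allFin m)
allFin-+ n m = trans (tabulate-+ n m id)
  (sym (cong₂ _++_ (map-tabulate id (_↑ˡ m)) (map-tabulate id (n ↑ʳ_))))

T-foldr-∧ : (g : A → Bool) (xs : List A) → T (foldr (λ x b → b ∧ g x) true xs) ⇔ All (T ∘ g) xs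
T-foldr-∧ g []       = mk⇔ (λ _ → All.[]) _
T-foldr-∧ g (x ∷ xs) = mk⇔ to from
  where
  to : T (foldr (λ x b → b ∧ g x) true (x ∷ xs)) → All (T ∘ g) (x ∷ xs)
  to t = proj₂ t′ All.∷ Equivalence.to (T-foldr-∧ g xs) (proj₁ t′)
    where t′ = Equivalence.to T-∧ t
  from : All (T ∘ g) (x ∷ xs) → T (foldr (λ x b → b ∧ g x) true (x ∷ xs))
  from (px All.∷ pxs) = Equivalence.from T-∧ (Equivalence.from (T-foldr-∧ g xs) pxs , px)

T-nand₃ : ∀ a b c → T (not (a ∧ b ∧ c)) ⇔ (a ≡ true → b ≡ true → c ≡ false)
T-nand₃ true  true  c = mk⇔ (λ t _ _ → Equivalence.to T-not-≡ t) (λ f → Equivalence.from T-not-≡ (f refl refl))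
T-nand₃ true  false c = mk⇔ (λ _ _ ()) _
T-nand₃ false b     c = mk⇔ (λ _ ()) _

SpansNoEdge : SimpleGraph n → Subset n → Set
SpansNoEdge H S = ∀ i j → lookup S i ≡ true → lookup S j ≡ true → adj H i j ≡ false

independent⇔spansNoEdge : (H : SimpleGraph n) (S : Subset n) → Independent H S ⇔ SpansNoEdge H S
independent⇔spansNoEdge {n} H S = mk⇔ to from
  where
  nand : Fin n × Fin n → Bool
  nand (i , j) = not (lookup S i ∧ lookup S j ∧ adj H i j)
  to : Independent H S → SpansNoEdge H S
  to ind i j = Equivalence.to (T-nand₃ _ _ _)
    (All.lookup (Equivalence.to (T-foldr-∧ nand (pairs n)) ind) (∈-cartesianProduct⁺ (∈-allFin i) (∈-allFin j)))
  from : SpansNoEdge H S → Independent H S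
  from noEdge = Equivalence.from (T-foldr-∧ nand (pairs n))
    (All.universal (λ p → Equivalence.from (T-nand₃ _ _ _) (noEdge (proj₁ p) (proj₂ p))) (pairs n))

IsEdge : SimpleGraph n → Pred (Fin n × Fin n) _
IsEdge G p = toℕ (proj₁ p) < toℕ (proj₂ p) × adj G (proj₁ p) (proj₂ p) ≡ true

isEdge? : (G : SimpleGraph n) → Decidable (IsEdge G)
isEdge? G p = (toℕ (proj₁ p) <? toℕ (proj₂ p)) ×-dec (adj G (proj₁ p) (proj₂ p) ≟ true)

liftAdj : (Fin n → Fin n → Bool) → Fin n ⊎ Fin m → Fin n ⊎ Fin m → Bool
liftAdj E (inj₁ x) (inj₁ y) = E x y
liftAdj E (inj₁ x) (inj₂ w) = false
liftAdj E (inj₂ z) q        = false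

addIsolated : SimpleGraph n → (m : ℕ) → SimpleGraph (n + m)
addIsolated {n} H m = record
  { adj   = λ i j → liftAdj (adj H) (splitAt n i) (splitAt n j)
  ; sym   = λ i j → liftAdj-sym (splitAt n i) (splitAt n j)
  ; irrfl = λ i → liftAdj-irrfl (splitAt n i)
  }
  where
  liftAdj-sym : ∀ p q → liftAdj {m = m} (adj H) p q ≡ liftAdj (adj H) q p
  liftAdj-sym (inj₁ x) (inj₁ y) = SimpleGraph.sym H x y
  liftAdj-sym (inj₁ x) (inj₂ w) = refl
  liftAdj-sym (inj₂ z) (inj₁ y) = refl
  liftAdj-sym (inj₂ z) (inj₂ w) = refl
  liftAdj-irrfl : ∀ p → liftAdj {m = m} (adj H) p p ≡ false
  liftAdj-irrfl (inj₁ x) = irrfl H x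
  liftAdj-irrfl (inj₂ z) = refl

∣p++q∣≡∣p∣+∣q∣ : (p : Subset n) (q : Subset m) → ∣ p Vec.++ q ∣ ≡ ∣ p ∣ + ∣ q ∣
∣p++q∣≡∣p∣+∣q∣ Vec.[]            q = refl
∣p++q∣≡∣p∣+∣q∣ (inside  Vec.∷ p) q = cong suc (∣p++q∣≡∣p∣+∣q∣ p q)
∣p++q∣≡∣p∣+∣q∣ (outside Vec.∷ p) q = ∣p++q∣≡∣p∣+∣q∣ p q

take-++ : (p : Vec.Vec A n) (q : Vec.Vec A m) → take n (p Vec.++ q) ≡ p
take-++ {n = n} p q = ++-injectiveˡ (take n (p Vec.++ q)) p (take++drop≡id n (p Vec.++ q))

lookup-↑ˡ : (p : Vec.Vec A (n + m)) (x : Fin n) → lookup p (x ↑ˡ m) ≡ lookup (take n p) x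
lookup-↑ˡ {n = n} {m = m} p x = trans (cong (λ q → lookup q (x ↑ˡ m)) (sym (take++drop≡id n p)))
                                      (lookup-++ˡ (take n p) (drop n p) x)

⊥++⊥ : ⊥ {n} Vec.++ ⊥ {m} ≡ ⊥
⊥++⊥ {zero}  = refl
⊥++⊥ {suc n} {m} = cong (outside Vec.∷_) (⊥++⊥ {n} {m})

⁅x↑ˡ⁆≡⁅x⁆++⊥ : (x : Fin n) → ⁅ x ↑ˡ m ⁆ ≡ ⁅ x ⁆ Vec.++ ⊥
⁅x↑ˡ⁆≡⁅x⁆++⊥ {suc n} {m} Fin.zero = cong (inside Vec.∷_) (sym (⊥++⊥ {n} {m}))
⁅x↑ˡ⁆≡⁅x⁆++⊥ (Fin.suc x) = cong (outside Vec.∷_) (⁅x↑ˡ⁆≡⁅x⁆++⊥ x)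

p++r─q++s≡p─q++r─s : (p q : Subset n) (r s : Subset m) → (p Vec.++ r) ─ (q Vec.++ s) ≡ (p ─ q) Vec.++ (r ─ s)
p++r─q++s≡p─q++r─s Vec.[]      Vec.[]            r s = refl
p++r─q++s≡p─q++r─s (x Vec.∷ p) (inside  Vec.∷ q) r s = cong (outside Vec.∷_) (p++r─q++s≡p─q++r─s p q r s)
p++r─q++s≡p─q++r─s (x Vec.∷ p) (outside Vec.∷ q) r s = cong (x Vec.∷_) (p++r─q++s≡p─q++r─s p q r s)

p─q≡⁅x⁆⇔p++⊤─q++⊤≡⁅x↑ˡ⁆ : (p q : Subset n) (x : Fin n) →
  (p ─ q ≡ ⁅ x ⁆) ⇔ ((p Vec.++ ⊤ {m}) ─ (q Vec.++ ⊤) ≡ ⁅ x ↑ˡ m ⁆)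
p─q≡⁅x⁆⇔p++⊤─q++⊤≡⁅x↑ˡ⁆ {m = m} p q x
  rewrite p++r─q++s≡p─q++r─s p q (⊤ {m}) ⊤ | p─⊤≡⊥ (⊤ {m}) | ⁅x↑ˡ⁆≡⁅x⁆++⊥ {m = m} x
  = mk⇔ (cong (Vec._++ ⊥)) (++-injectiveˡ (p ─ q) ⁅ x ⁆)

m+n≡o+p⇒m≡o×n≡p : ∀ {k l a b} → k ≤ a → l ≤ b → k + l ≡ a + b → k ≡ a × l ≡ b
m+n≡o+p⇒m≡o×n≡p k≤a l≤b eq with m≤n⇒m<n∨m≡n k≤a
... | inj₁ k<a  = ⊥-elim (<-irrefl eq (+-mono-<-≤ k<a l≤b))
... | inj₂ refl = refl , +-cancelˡ-≡ _ _ _ eq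

TS-vertex-≡ : ∀ k (G : SimpleGraph n) {I J : V (TS k G)} → proj₁ I ≡ proj₁ J → I ≡ J
TS-vertex-≡ k G {S , ind , size} {.S , ind′ , size′} refl =
  cong₂ (λ i s → S , i , s) (T-irrelevant ind ind′) (≡-irrelevant size size′)

module AddIsolated {n : ℕ} (H : SimpleGraph n) (m : ℕ) where

  H⁺ : SimpleGraph (n + m)
  H⁺ = addIsolated H m

  adj-↑ˡ : ∀ x y → adj H⁺ (x ↑ˡ m) (y ↑ˡ m) ≡ adj H x y
  adj-↑ˡ x y rewrite splitAt-↑ˡ n x m | splitAt-↑ˡ n y m = refl

  adj-↑ʳ₁ : ∀ z j → adj H⁺ (n ↑ʳ z) j ≡ false
  adj-↑ʳ₁ z j rewrite splitAt-↑ʳ n m z = refl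

  adj-↑ʳ₂ : ∀ i z → adj H⁺ i (n ↑ʳ z) ≡ false
  adj-↑ʳ₂ i z = trans (SimpleGraph.sym H⁺ i (n ↑ʳ z)) (adj-↑ʳ₁ z i)

  adj≡true⇒↑ˡ : ∀ i j → adj H⁺ i j ≡ true →
    Σ[ x ∈ Fin n ] Σ[ y ∈ Fin n ] (x ↑ˡ m ≡ i × y ↑ˡ m ≡ j × adj H x y ≡ true)
  adj≡true⇒↑ˡ i j e with splitAt n i in eqi | splitAt n j in eqj
  ... | inj₁ x | inj₁ y = x , y , splitAt⁻¹-↑ˡ eqi , splitAt⁻¹-↑ˡ eqj , e
  ... | inj₁ x | inj₂ w with () ← e
  ... | inj₂ z | _      with () ← e

  isEdge-↑ˡ : ∀ x y → IsEdge H⁺ (x ↑ˡ m , y ↑ˡ m) ≡ IsEdge H (x , y)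
  isEdge-↑ˡ x y rewrite toℕ-↑ˡ x m | toℕ-↑ˡ y m | adj-↑ˡ x y = refl

  ¬isEdge : ∀ {i j} → adj H⁺ i j ≡ false → ¬ IsEdge H⁺ (i , j)
  ¬isEdge i≁j (_ , i∼j) with () ← trans (sym i≁j) i∼j

  edgeCount-addIsolated : edgeCount H⁺ ≡ edgeCount H
  edgeCount-addIsolated = begin
    count (isEdge? H⁺) (cartesianProduct (allFin (n + m)) (allFin (n + m)))
      ≡⟨ cong (λ vs → count (isEdge? H⁺) (cartesianProduct vs vs)) (allFin-+ n m) ⟩
    count (isEdge? H⁺) (cartesianProduct (old ++ new) (old ++ new))
      ≡⟨ count-cartesianProduct-++ (isEdge? H⁺) (_↑ˡ m) (n ↑ʳ_)
           (λ z j → ¬isEdge (adj-↑ʳ₁ z j)) (λ i z → ¬isEdge (adj-↑ʳ₂ i z))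
           (allFin n) (allFin m) (allFin n) (allFin m) ⟩
    count (isEdge? H⁺ ∘ Product.map (_↑ˡ m) (_↑ˡ m)) (pairs n)
      ≡⟨ count-≐ _ (isEdge? H) (subst id (isEdge-↑ˡ _ _) , subst id (sym (isEdge-↑ˡ _ _))) (pairs n) ⟩
    edgeCount H ∎
    where
    open ≡-Reasoning
    old = map (_↑ˡ m) (allFin n)
    new = map (n ↑ʳ_) (allFin m)

  ++⊤-spansNoEdge : ∀ {S} → SpansNoEdge H S → SpansNoEdge H⁺ (S Vec.++ ⊤)
  ++⊤-spansNoEdge {S} noEdge i j
    rewrite lookup-splitAt n S ⊤ i | lookup-splitAt n S ⊤ j
    with splitAt n i | splitAt n j
  ... | inj₁ x | inj₁ y = noEdge x y
  ... | inj₁ x | inj₂ w = λ _ _ → refl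
  ... | inj₂ z | _      = λ _ _ → refl

  take-spansNoEdge : ∀ {U} → SpansNoEdge H⁺ U → SpansNoEdge H (take n U)
  take-spansNoEdge {U} noEdge x y x∈U y∈U = trans (sym (adj-↑ˡ x y))
    (noEdge (x ↑ˡ m) (y ↑ˡ m) (trans (lookup-↑ˡ U x) x∈U) (trans (lookup-↑ˡ U y) y∈U))

module _ {n : ℕ} (H : SimpleGraph n) {a : ℕ} (α : IsIndependenceNumber H a) (m : ℕ) where
  open AddIsolated H m

  private
    independent-++⊤ : ∀ S → Independent H S → Independent H⁺ (S Vec.++ ⊤)
    independent-++⊤ S = Equivalence.from (independent⇔spansNoEdge H⁺ (S Vec.++ ⊤))
                        ∘ ++⊤-spansNoEdge {S} ∘ Equivalence.to (independent⇔spansNoEdge H S)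

    independent-take : ∀ U → Independent H⁺ U → Independent H (take n U)
    independent-take U = Equivalence.from (independent⇔spansNoEdge H (take n U))
                          ∘ take-spansNoEdge {U} ∘ Equivalence.to (independent⇔spansNoEdge H⁺ U)

    sizes-take-drop : ∀ U → Independent H⁺ U → ∣ U ∣ ≡ a + m → ∣ take n U ∣ ≡ a × ∣ drop n U ∣ ≡ m
    sizes-take-drop U ind size =
      m+n≡o+p⇒m≡o×n≡p (proj₂ α (take n U) (independent-take U ind)) (∣p∣≤n (drop n U)) (begin
        ∣ take n U ∣ + ∣ drop n U ∣  ≡⟨ ∣p++q∣≡∣p∣+∣q∣ (take n U) (drop n U) ⟨
        ∣ take n U Vec.++ drop n U ∣ ≡⟨ cong ∣_∣ (take++drop≡id n U) ⟩
        ∣ U ∣                        ≡⟨ size ⟩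
        a + m                        ∎)
      where open ≡-Reasoning

    extend : V (TS a H) → V (TS (a + m) H⁺)
    extend (S , ind , size) =
      S Vec.++ ⊤ , independent-++⊤ S ind , trans (∣p++q∣≡∣p∣+∣q∣ S ⊤) (cong₂ _+_ size (∣⊤∣≡n m))

    restrict : V (TS (a + m) H⁺) → V (TS a H)
    restrict (U , ind , size) = take n U , independent-take U ind , proj₁ (sizes-take-drop U ind size)

    extend-restrict : ∀ J → extend (restrict J) ≡ J
    extend-restrict J@(U , ind , size) = TS-vertex-≡ (a + m) H⁺ (begin
      take n U Vec.++ ⊤        ≡⟨ cong (take n U Vec.++_) (∣p∣≡n⇒p≡⊤ (proj₂ (sizes-take-drop U ind size))) ⟨
      take n U Vec.++ drop n U ≡⟨ take++drop≡id n U ⟩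
      U                        ∎)
      where open ≡-Reasoning

    restrict-extend : ∀ I → restrict (extend I) ≡ I
    restrict-extend I = TS-vertex-≡ a H (take-++ (proj₁ I) ⊤)

    extend-Adj⇔ : ∀ I J → Adj (TS a H) I J ⇔ Adj (TS (a + m) H⁺) (extend I) (extend J)
    extend-Adj⇔ I@(S , _) J@(S′ , _) = mk⇔ to from
      where
      to : Adj (TS a H) I J → Adj (TS (a + m) H⁺) (extend I) (extend J)
      to (u , v , S─S′ , S′─S , u∼v) =
        u ↑ˡ m , v ↑ˡ m ,
        Equivalence.to (p─q≡⁅x⁆⇔p++⊤─q++⊤≡⁅x↑ˡ⁆ S S′ u) S─S′ ,
        Equivalence.to (p─q≡⁅x⁆⇔p++⊤─q++⊤≡⁅x↑ˡ⁆ S′ S v) S′─S ,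
        trans (adj-↑ˡ u v) u∼v
      from : Adj (TS (a + m) H⁺) (extend I) (extend J) → Adj (TS a H) I J
      from (u′ , v′ , S─S′ , S′─S , u′∼v′) with adj≡true⇒↑ˡ u′ v′ u′∼v′
      ... | u , v , refl , refl , u∼v =
        u , v ,
        Equivalence.from (p─q≡⁅x⁆⇔p++⊤─q++⊤≡⁅x↑ˡ⁆ S S′ u) S─S′ ,
        Equivalence.from (p─q≡⁅x⁆⇔p++⊤─q++⊤≡⁅x↑ˡ⁆ S′ S v) S′─S ,
        u∼v

  TS-addIsolated : TS a H ≃G TS (a + m) (addIsolated H m)
  TS-addIsolated = mk↔ₛ′ extend restrict extend-restrict restrict-extend , extend-Adj⇔

proposition2 : ∀ {n} (H : SimpleGraph n) (a : ℕ) → IsIndependenceNumber H a →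
    ∀ (k : ℕ) → a ≤ k →
      Σ[ H′ ∈ SimpleGraph (n + (k ∸ a)) ] ((edgeCount H′ ≡ edgeCount H) × (TS a H ≃G TS k H′))
proposition2 H a α k a≤k =
  addIsolated H (k ∸ a) ,
  AddIsolated.edgeCount-addIsolated H (k ∸ a) ,
  subst (λ k′ → TS a H ≃G TS k′ (addIsolated H (k ∸ a))) (m+[n∸m]≡n a≤k) (TS-addIsolated H α (k ∸ a))
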